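{- Let $n \geq 2$ and let $A$ be a cyclic permutation group of order $2^n$ on a finite set. If $A$ has at least one orbit of cardinality $2$ and exactly one orbit of cardinality greater than $2$, then $A \notin GR$.
   Context: A cyclic permutation group is a permutation group generated by a single permutation; its order is the number of its elements. A $k$-colored graph $G=(V,E)$ consists of a finite set $V$ and a function $E$ from the 2-element subsets of $V$ to $\{0,\ldots,k-1\}$. An automorphism of $G$ is a permutation of $V$ preserving $E$; $Aut(G)$ is the automorphism group as a permutation group on $V$. $GR$ is the class of permutation groups $(A,V)$ with $A=Aut(G)$ for some $k$-colored graph $G$ on $V$, for some $k$. -}

module Defs where

open import Data.Nat using (ℕ; zero; suc; _<_; _≤_)
open import Data.Fin using (Fin)
open import Data.Fin.Permutation using (Permutation′; _⟨$⟩ʳ_)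
open import Data.Product using (Σ; ∃; _×_)
open import Relation.Binary.PropositionalEquality using (_≡_; _≢_)
open import Relation.Nullary using (¬_)

pow : ∀ {m} → Permutation′ m → ℕ → Fin m → Fin m
pow σ zero    x = x
pow σ (suc i) x = σ ⟨$⟩ʳ (pow σ i x)

_≗ₚ_ : ∀ {m} → (Fin m → Fin m) → (Fin m → Fin m) → Set
f ≗ₚ g = ∀ x → f x ≡ g x

-- The cyclic group ⟨σ⟩ has exactly N elements: its elements are
-- σ^0, …, σ^(N-1) (since σ^N = id) and these are pairwise distinct.
cyclicOrder : ∀ {m} → Permutation′ m → ℕ → Set
cyclicOrder σ N =
  (0 < N) ×
  (pow σ N ≗ₚ (λ x → x)) ×
  (∀ i j → i < N → j < N → pow σ i ≗ₚ pow σ j → i ≡ j)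

inOrbit : ∀ {m} → Permutation′ m → Fin m → Fin m → Set
inOrbit σ x y = ∃ λ i → pow σ i x ≡ y

-- The ⟨σ⟩-orbit of x has exactly d elements: {σ^i x | i < d}, pairwise distinct,
-- and σ^d x = x (so every σ^i x is among them).
orbitSize : ∀ {m} → Permutation′ m → Fin m → ℕ → Set
orbitSize σ x d =
  (0 < d) ×
  (pow σ d x ≡ x) ×
  (∀ i j → i < d → j < d → pow σ i x ≡ pow σ j x → i ≡ j)

-- A k-colored graph on Fin m: a colouring of the 2-element subsets {x,y},
-- represented by a function E symmetric on distinct pairs (diagonal ignored).
record ColoredGraph (m k : ℕ) : Set where
  field
    E   : Fin m → Fin m → Fin k
    sym : ∀ x y → x ≢ y → E x y ≡ E y x

IsAut : ∀ {m k} → ColoredGraph m k → Permutation′ m → Set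
IsAut G π = ∀ x y → x ≢ y → E (π ⟨$⟩ʳ x) (π ⟨$⟩ʳ y) ≡ E x y
  where open ColoredGraph G

-- The cyclic permutation group ⟨σ⟩ on Fin m is in GR: there is a k-colored
-- graph G whose automorphism group is exactly ⟨σ⟩.
CyclicInGR : ∀ {m} → Permutation′ m → Set
CyclicInGR {m} σ =
  Σ ℕ λ k → Σ (ColoredGraph m k) λ G →
    ∀ (π : Permutation′ m) →
      (IsAut G π → ∃ λ i → (π ⟨$⟩ʳ_) ≗ₚ pow σ i) ×
      ((∃ λ i → (π ⟨$⟩ʳ_) ≗ₚ pow σ i) → IsAut G π)

-- Write O = {x, σx, …, σ^(d-1) x} and let ρ be the reflection of O,
-- ρ (σ^a x) = σ^(d-a) x, extended by the identity outside O.  Every other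
-- orbit has size at most 2, so σ² fixes every point outside O.  Then on
-- every pair {p, q} of distinct points ρ acts like some power σ^t (possibly
-- exchanging p and q):
--   * p = σ^a x, q = σ^b x :  σ^((d-a)+(d-b)) swaps p ↦ ρ q and q ↦ ρ p;
--   * p = σ^a x, q ∉ O     :  σ^(2(d-a)) maps p ↦ ρ p and fixes q;
--   * p, q ∉ O             :  σ^0.
-- Since the colour of a 2-subset is unordered, ρ preserves every colouring
-- preserved by all powers of σ, so ρ ∈ Aut(G) whenever ⟨σ⟩ ⊆ Aut(G).  But
-- ρ ∉ ⟨σ⟩: a power fixing x fixes σx, whereas ρ (σx) = σ^(d-1) x ≠ σx.

module Submission where

open import Defs
open import Data.Nat using (ℕ; _<_; _≤_; _^_; zero; suc; _+_; _*_; _∸_; z≤n; s≤s; s≤s⁻¹; NonZero; >-nonZero)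
open import Data.Nat.Properties
open import Data.Nat.DivMod using (_%_; _/_; m≡m%n+[m/n]*n; m%n<n)
open import Data.Fin using (Fin; toℕ; fromℕ; fromℕ<; inject)
open import Data.Fin.Properties using (any?; toℕ<n; toℕ-fromℕ; toℕ-fromℕ<; toℕ-inject; ¬∀⟶∃¬-smallest) renaming (_≟_ to _≟F_)
open import Data.Fin.Permutation using (Permutation′; _⟨$⟩ʳ_; _⟨$⟩ˡ_; inverseˡ; permutation; _∘ₚ_) renaming (id to idₚ)
open import Data.Product using (Σ; ∃; _×_; _,_; proj₁; proj₂)
open import Data.Sum using (_⊎_; inj₁; inj₂)
open import Data.Empty using (⊥-elim)
open import Relation.Nullary using (¬_; Dec; yes; no)
open import Relation.Nullary.Decidable using (¬?; decidable-stable)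
open import Relation.Binary using (tri<; tri≈; tri>)
open import Relation.Binary.PropositionalEquality using (_≡_; _≢_; refl; sym; trans; cong; cong₂; module ≡-Reasoning)

module Powers {m : ℕ} (σ : Permutation′ m) where

  pow-add : ∀ i j y → pow σ (i + j) y ≡ pow σ i (pow σ j y)
  pow-add zero    j y = refl
  pow-add (suc i) j y = cong (σ ⟨$⟩ʳ_) (pow-add i j y)

  pow-comm : ∀ i j y → pow σ i (pow σ j y) ≡ pow σ j (pow σ i y)
  pow-comm i j y = trans (sym (pow-add i j y))
                     (trans (cong (λ k → pow σ k y) (+-comm i j)) (pow-add j i y))

  pow-injective : ∀ i {a b} → pow σ i a ≡ pow σ i b → a ≡ b
  pow-injective zero    e = e
  pow-injective (suc i) e =
    pow-injective i (trans (sym (inverseˡ σ)) (trans (cong (σ ⟨$⟩ˡ_) e) (inverseˡ σ)))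

  pow-multiple : ∀ {e y} → pow σ e y ≡ y → ∀ c → pow σ (c * e) y ≡ y
  pow-multiple         fixed zero    = refl
  pow-multiple {e} {y} fixed (suc c) =
    trans (pow-add e (c * e) y) (trans (cong (pow σ e) (pow-multiple fixed c)) fixed)

  pow-mod : ∀ {e y} .{{_ : NonZero e}} → pow σ e y ≡ y → ∀ i → pow σ i y ≡ pow σ (i % e) y
  pow-mod {e} {y} fixed i = begin
    pow σ i y                                ≡⟨ cong (λ k → pow σ k y) (m≡m%n+[m/n]*n i e) ⟩
    pow σ (i % e + (i / e) * e) y            ≡⟨ pow-add (i % e) ((i / e) * e) y ⟩
    pow σ (i % e) (pow σ ((i / e) * e) y)    ≡⟨ cong (pow σ (i % e)) (pow-multiple fixed (i / e)) ⟩
    pow σ (i % e) y                          ∎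
    where open ≡-Reasoning

  pow-cancel : ∀ {e y a} → pow σ e y ≡ y → a ≤ e → pow σ (e ∸ a) (pow σ a y) ≡ y
  pow-cancel {e} {y} {a} fixed a≤e =
    trans (sym (pow-add (e ∸ a) a y)) (trans (cong (λ k → pow σ k y) (m∸n+n≡m a≤e)) fixed)

  powPerm : ℕ → Permutation′ m
  powPerm zero    = idₚ
  powPerm (suc t) = powPerm t ∘ₚ σ

  powPerm-correct : ∀ t y → powPerm t ⟨$⟩ʳ y ≡ pow σ t y
  powPerm-correct zero    y = refl
  powPerm-correct (suc t) y = cong (σ ⟨$⟩ʳ_) (powPerm-correct t y)

  minimal-period⇒orbitSize : ∀ {e y} → 0 < e → pow σ e y ≡ y →
    (∀ k → 0 < k → k < e → pow σ k y ≢ y) → orbitSize σ y e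
  minimal-period⇒orbitSize {e} {y} 0<e fixed minimal = 0<e , fixed , distinct
    where
    -- σ^i y = σ^j y with i < j makes j - i a smaller period.
    no-gap : ∀ i j → i < j → j < e → pow σ i y ≢ pow σ j y
    no-gap i j i<j j<e e-ij = minimal (j ∸ i) (m<n⇒0<n∸m i<j) (≤-<-trans (m∸n≤m j i) j<e)
      (pow-injective i (trans (sym (pow-add i (j ∸ i) y))
        (trans (cong (λ k → pow σ k y) (m+[n∸m]≡n (<⇒≤ i<j))) (sym e-ij))))
    distinct : ∀ i j → i < e → j < e → pow σ i y ≡ pow σ j y → i ≡ j
    distinct i j i<e j<e e-ij with <-cmp i j
    ... | tri< i<j _ _ = ⊥-elim (no-gap i j i<j j<e e-ij)
    ... | tri≈ _ i≡j _ = i≡j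
    ... | tri> _ _ j<i = ⊥-elim (no-gap j i j<i i<e (sym e-ij))

  orbitSize-exists : ∀ N y → pow σ (suc N) y ≡ y → ∃ λ e → orbitSize σ y e
  orbitSize-exists N y fixed with ¬∀⟶∃¬-smallest (suc N) NotPeriod NotPeriod? N-is-period
    where
    NotPeriod : Fin (suc N) → Set
    NotPeriod i = pow σ (suc (toℕ i)) y ≢ y
    NotPeriod? : ∀ i → Dec (NotPeriod i)
    NotPeriod? i = ¬? (pow σ (suc (toℕ i)) y ≟F y)
    N-is-period : ¬ (∀ i → NotPeriod i)
    N-is-period all = all (fromℕ N) (trans (cong (λ k → pow σ (suc k) y) (toℕ-fromℕ N)) fixed)
  ... | i , ¬¬period , smaller =
    suc (toℕ i) , minimal-period⇒orbitSize (s≤s z≤n)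
                    (decidable-stable (pow σ (suc (toℕ i)) y ≟F y) ¬¬period) minimal
    where
    minimal : ∀ k → 0 < k → k < suc (toℕ i) → pow σ k y ≢ y
    minimal (suc k) _ k<1+i σᵏy≡y =
      smaller j (trans (cong (λ l → pow σ (suc l) y) toℕ-j) σᵏy≡y)
      where
      k<i : k < toℕ i
      k<i = s≤s⁻¹ k<1+i
      j : Fin (toℕ i)
      j = fromℕ< k<i
      toℕ-j : toℕ (inject j) ≡ k
      toℕ-j = trans (toℕ-inject j) (toℕ-fromℕ< k<i)

  small-orbit⇒σ²-fixed : ∀ {y e} → orbitSize σ y e → e ≤ 2 → pow σ 2 y ≡ y
  small-orbit⇒σ²-fixed {e = 1} (_ , σy≡y , _) _ = trans (cong (σ ⟨$⟩ʳ_) σy≡y) σy≡y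
  small-orbit⇒σ²-fixed {e = 2} (_ , σ²y≡y , _) _ = σ²y≡y
  small-orbit⇒σ²-fixed {e = suc (suc (suc _))} _ (s≤s (s≤s ()))

  ActsLikePower : (Fin m → Fin m) → Fin m → Fin m → Set
  ActsLikePower f p q = ∃ λ t →
    (pow σ t p ≡ f p × pow σ t q ≡ f q) ⊎ (pow σ t p ≡ f q × pow σ t q ≡ f p)

  ActsLikePower-swap : ∀ {f p q} → ActsLikePower f p q → ActsLikePower f q p
  ActsLikePower-swap (t , inj₁ (ep , eq)) = t , inj₁ (eq , ep)
  ActsLikePower-swap (t , inj₂ (ep , eq)) = t , inj₂ (eq , ep)

  acts-like-powers⇒preserves : ∀ {k} (G : ColoredGraph m k) (f : Fin m → Fin m) →
    let open ColoredGraph G in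
    (∀ t p q → p ≢ q → E (pow σ t p) (pow σ t q) ≡ E p q) →
    (∀ p q → p ≢ q → ActsLikePower f p q) →
    ∀ p q → p ≢ q → E (f p) (f q) ≡ E p q
  acts-like-powers⇒preserves G f powers-preserve acts p q p≢q = from-action (acts p q p≢q)
    where
    open ColoredGraph G using (E) renaming (sym to E-sym)
    q≢p : q ≢ p
    q≢p q≡p = p≢q (sym q≡p)
    from-action : ActsLikePower f p q → E (f p) (f q) ≡ E p q
    from-action (t , inj₁ (ep , eq)) = trans (cong₂ E (sym ep) (sym eq)) (powers-preserve t p q p≢q)
    from-action (t , inj₂ (ep , eq)) =
      trans (cong₂ E (sym eq) (sym ep)) (trans (powers-preserve t q p q≢p) (E-sym q p q≢p))

module Reflection {m : ℕ} (σ : Permutation′ m) {x : Fin m} {d : ℕ} (size : orbitSize σ x d) where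
  open Powers σ

  private
    instance
      d-nonZero : NonZero d
      d-nonZero = >-nonZero (proj₁ size)

    period : pow σ d x ≡ x
    period = proj₁ (proj₂ size)

  OrbitPosition : Fin m → Set
  OrbitPosition y = (∃ λ a → a < d × pow σ a x ≡ y) ⊎ ¬ inOrbit σ x y

  orbit-or-not : ∀ y → OrbitPosition y
  orbit-or-not y with any? (λ (i : Fin d) → pow σ (toℕ i) x ≟F y)
  ... | yes (i , e) = inj₁ (toℕ i , toℕ<n i , e)
  ... | no none = inj₂ λ (a , e) →
    none (fromℕ< (m%n<n a d) , trans (cong (λ k → pow σ k x) (toℕ-fromℕ< (m%n<n a d)))
                                      (trans (sym (pow-mod period a)) e))

  reflection-well-defined : ∀ {a b} → a ≤ d → b ≤ d → pow σ a x ≡ pow σ b x →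
    pow σ (d ∸ a) x ≡ pow σ (d ∸ b) x
  reflection-well-defined {a} {b} a≤d b≤d e = pow-injective a (begin
    pow σ a (pow σ (d ∸ a) x)        ≡⟨ pow-comm a (d ∸ a) x ⟩
    pow σ (d ∸ a) (pow σ a x)        ≡⟨ pow-cancel period a≤d ⟩
    x                                ≡⟨ sym (pow-cancel period b≤d) ⟩
    pow σ (d ∸ b) (pow σ b x)        ≡⟨ cong (pow σ (d ∸ b)) (sym e) ⟩
    pow σ (d ∸ b) (pow σ a x)        ≡⟨ pow-comm (d ∸ b) a x ⟩
    pow σ a (pow σ (d ∸ b) x)        ∎)
    where open ≡-Reasoning

  reflect : Fin m → Fin m
  reflect y with orbit-or-not y
  ... | inj₁ (a , _ , _) = pow σ (d ∸ a) x
  ... | inj₂ _           = y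

  reflect-on-orbit : ∀ a → a ≤ d → reflect (pow σ a x) ≡ pow σ (d ∸ a) x
  reflect-on-orbit a a≤d with orbit-or-not (pow σ a x)
  ... | inj₁ (b , b<d , e) = reflection-well-defined (<⇒≤ b<d) a≤d e
  ... | inj₂ not-in        = ⊥-elim (not-in (a , refl))

  reflect-off-orbit : ∀ y → ¬ inOrbit σ x y → reflect y ≡ y
  reflect-off-orbit y not-in with orbit-or-not y
  ... | inj₁ (a , _ , e) = ⊥-elim (not-in (a , e))
  ... | inj₂ _           = refl

  reflect-involutive : ∀ y → reflect (reflect y) ≡ y
  reflect-involutive y with orbit-or-not y
  ... | inj₁ (a , a<d , refl) = trans (reflect-on-orbit (d ∸ a) (m∸n≤m d a))
                                  (cong (λ k → pow σ k x) (m∸[m∸n]≡n (<⇒≤ a<d)))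
  ... | inj₂ not-in           = reflect-off-orbit y not-in

  reflectPerm : Permutation′ m
  reflectPerm = permutation reflect reflect reflect-involutive reflect-involutive

  rotate : ∀ {a} c → a ≤ d → pow σ ((d ∸ a) + c) (pow σ a x) ≡ pow σ c x
  rotate {a} c a≤d =
    trans (cong (λ k → pow σ k (pow σ a x)) (+-comm (d ∸ a) c))
      (trans (pow-add c (d ∸ a) _) (cong (pow σ c) (pow-cancel period a≤d)))

  acts-in-orbit : ∀ {a b} → a ≤ d → b ≤ d → ActsLikePower reflect (pow σ a x) (pow σ b x)
  acts-in-orbit {a} {b} a≤d b≤d = (d ∸ a) + (d ∸ b) , inj₂
    ( trans (rotate (d ∸ b) a≤d) (sym (reflect-on-orbit b b≤d))
    , trans (cong (λ k → pow σ k (pow σ b x)) (+-comm (d ∸ a) (d ∸ b)))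
        (trans (rotate (d ∸ a) b≤d) (sym (reflect-on-orbit a a≤d))) )

  acts-in-orbit-fixed : ∀ {a q} → a ≤ d → ¬ inOrbit σ x q → pow σ 2 q ≡ q →
    ActsLikePower reflect (pow σ a x) q
  acts-in-orbit-fixed {a} {q} a≤d not-in σ²q≡q = 2 * (d ∸ a) , inj₁
    ( trans (rotate ((d ∸ a) + 0) a≤d)
        (trans (cong (λ k → pow σ k x) (+-identityʳ (d ∸ a))) (sym (reflect-on-orbit a a≤d)))
    , trans (cong (λ k → pow σ k q) (*-comm 2 (d ∸ a)))
        (trans (pow-multiple σ²q≡q (d ∸ a)) (sym (reflect-off-orbit q not-in))) )

  reflect-acts-like-power : (∀ q → ¬ inOrbit σ x q → pow σ 2 q ≡ q) →
    ∀ p q → ActsLikePower reflect p q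
  reflect-acts-like-power outside p q = by-position (orbit-or-not p) (orbit-or-not q)
    where
    by-position : ∀ {p q} → OrbitPosition p → OrbitPosition q → ActsLikePower reflect p q
    by-position (inj₁ (a , a<d , refl)) (inj₁ (b , b<d , refl)) = acts-in-orbit (<⇒≤ a<d) (<⇒≤ b<d)
    by-position (inj₁ (a , a<d , refl)) (inj₂ q∉O) =
      acts-in-orbit-fixed (<⇒≤ a<d) q∉O (outside _ q∉O)
    by-position (inj₂ p∉O) (inj₁ (b , b<d , refl)) =
      ActsLikePower-swap (acts-in-orbit-fixed (<⇒≤ b<d) p∉O (outside _ p∉O))
    by-position {p} {q} (inj₂ p∉O) (inj₂ q∉O) =
      0 , inj₁ (sym (reflect-off-orbit p p∉O) , sym (reflect-off-orbit q q∉O))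

  -- For d > 2 the reflection is not a power of σ: a power fixing x fixes σx,
  -- while the reflection fixes x and sends σx to σ^(d-1) x ≠ σx.
  reflect-not-power : 2 < d → ¬ ∃ λ i → reflect ≗ₚ pow σ i
  reflect-not-power 2<d (i , reflect≗σⁱ) = <-irrefl (sym d≡2) 2<d
    where
    1<d : 1 < d
    1<d = <-trans (s≤s (s≤s z≤n)) 2<d
    d-1<d : d ∸ 1 < d
    d-1<d = ∸-monoʳ-< {o = 0} (s≤s z≤n) (<⇒≤ 1<d)
    σⁱx≡x : pow σ i x ≡ x
    σⁱx≡x = trans (sym (reflect≗σⁱ x)) (trans (reflect-on-orbit 0 z≤n) period)
    σᵈ⁻¹x≡σx : pow σ (d ∸ 1) x ≡ pow σ 1 x
    σᵈ⁻¹x≡σx = trans (sym (reflect-on-orbit 1 (<⇒≤ 1<d)))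
      (trans (reflect≗σⁱ (pow σ 1 x)) (trans (pow-comm i 1 x) (cong (pow σ 1) σⁱx≡x)))
    d≡2 : d ≡ 2
    d≡2 = trans (sym (m+[n∸m]≡n (<⇒≤ 1<d)))
            (cong suc (proj₂ (proj₂ size) (d ∸ 1) 1 d-1<d 1<d σᵈ⁻¹x≡σx))

unique-large-orbit⇒¬GR : ∀ {m} (σ : Permutation′ m) (N : ℕ) → 0 < N → pow σ N ≗ₚ (λ x → x) →
  (Σ (Fin m) λ x → (∃ λ d → 2 < d × orbitSize σ x d) ×
    (∀ y → (∃ λ d → 2 < d × orbitSize σ y d) → inOrbit σ x y)) →
  ¬ CyclicInGR σ
unique-large-orbit⇒¬GR σ (suc N) _ σᴺ≗id (x , (d , 2<d , size) , unique) (_ , G , aut⇔power) =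
  reflect-not-power 2<d (proj₁ (aut⇔power reflectPerm) reflect-is-aut)
  where
  open Powers σ
  open Reflection σ size
  open ColoredGraph G using (E)

  powers-preserve : ∀ t p q → p ≢ q → E (pow σ t p) (pow σ t q) ≡ E p q
  powers-preserve t p q p≢q =
    trans (cong₂ E (sym (powPerm-correct t p)) (sym (powPerm-correct t q)))
      (proj₂ (aut⇔power (powPerm t)) (t , powPerm-correct t) p q p≢q)

  -- Outside the large orbit every orbit has size ≤ 2.
  outside-σ²-fixed : ∀ q → ¬ inOrbit σ x q → pow σ 2 q ≡ q
  outside-σ²-fixed q q∉O with orbitSize-exists N q (σᴺ≗id q)
  ... | e , size-q with ≤-<-connex e 2
  ...   | inj₁ e≤2 = small-orbit⇒σ²-fixed size-q e≤2
  ...   | inj₂ 2<e = ⊥-elim (q∉O (unique q (e , 2<e , size-q)))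

  reflect-is-aut : IsAut G reflectPerm
  reflect-is-aut = acts-like-powers⇒preserves G reflect powers-preserve
    (λ p q _ → reflect-acts-like-power outside-σ²-fixed p q)

lemma4p6 : ∀ (n m : ℕ) (σ : Permutation′ m) →
    2 ≤ n →
    cyclicOrder σ (2 ^ n) →
    (∃ λ x → orbitSize σ x 2) →
    (Σ (Fin m) λ x → (∃ λ d → 2 < d × orbitSize σ x d) ×
    (∀ y → (∃ λ d → 2 < d × orbitSize σ y d) → inOrbit σ x y)) →
    ¬ CyclicInGR σ
lemma4p6 n m σ _ (order-pos , σ^order≗id , _) _ unique-large-orbit =
  unique-large-orbit⇒¬GR σ (2 ^ n) order-pos σ^order≗id unique-large-orbit
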